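{- Let $m>0$. Let $2\le a\le b\le c$ and $2\le a'\le b'\le c'$ be integers such that $(F(a),F(b),F(c))$ and $(F(a'),F(b'),F(c'))$ are both minimal Markoff $m$-triples (for the same $m$). If $c\ge 20$, then $c=c'$.
   Context: $F(n)$ denotes the $n$-th Fibonacci number, $F(0)=0$, $F(1)=1$, $F(n+1)=F(n)+F(n-1)$. A Markoff $m$-triple is a triple $(x,y,z)$ of positive integers with $x\le y\le z$ satisfying $x^2+y^2+z^2=3xyz+m$; it is minimal if $z\ge 3xy$. -}

module Defs where

open import Data.Nat using (ℕ; zero; suc; _+_; _*_; _≤_; _<_)
open import Data.Product using (_×_)
open import Relation.Binary.PropositionalEquality using (_≡_)

F : ℕ → ℕ
F zero = 0
F (suc zero) = 1
F (suc (suc n)) = F (suc n) + F n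

MarkoffTriple : ℕ → ℕ → ℕ → ℕ → Set
MarkoffTriple m x y z =
  0 < x × x ≤ y × y ≤ z × x * x + y * y + z * z ≡ 3 * x * y * z + m

MinimalMarkoffTriple : ℕ → ℕ → ℕ → ℕ → Set
MinimalMarkoffTriple m x y z = MarkoffTriple m x y z × 3 * x * y ≤ z

-- Since F (a + b) < 3 F a F b, minimality forces
-- c ≥ a + b + 1. If c ≥ a + b + 2 then m > F (c − 1)². If c = a + b + 1 ("tight") then
-- m ≥ F (c − 2)² − 4, and m / F (c − 1)² lies in one of three short intervals, whereas for
-- every minimal triple with c ≥ 19 the ratio m / F c² avoids all three. Every Markoff triple
-- has m + z ≤ z², so a second minimal triple with c′ < c would give m + w ≤ w² ≤ m + 4 for
-- w = F (c − 1), resp. w = F (c − 2) when c′ ≤ c − 2 in the tight case; the remaining case,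
-- tight with c′ = c − 1, is excluded by the clash of ratios.
--
-- The ratio estimates reduce, via F (a + n + 1) = F (a + 1) F (n + 1) + F a F n and rational
-- bounds on F (k + 1) / F k, to linear inequalities between Gibonacci sequences, which hold
-- for all n as soon as they hold at two consecutive values. For the small values of a these
-- bounds are too coarse; there both sides are quadratic forms in (F b , F (b + 1)), which
-- Cassini's identity turns into linear ones.

module Submission where

open import Data.Bool using (T)
open import Data.Empty using (⊥; ⊥-elim)
open import Data.List using (List; []; _∷_; [_])
open import Data.Nat
open import Data.Nat.Properties
open import Data.Nat.Tactic.RingSolver using (solve-∀)
open import Data.Product using (_×_; _,_; proj₁; proj₂; ∃-syntax)
open import Data.Sum using (_⊎_; inj₁; inj₂)
open import Data.Unit using (tt)
open import Function.Base using (_$_)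
open import Relation.Binary using (tri<; tri≈; tri>)
open import Relation.Binary.PropositionalEquality hiding ([_])
open import Relation.Nullary using (¬_; yes; no)

open import Defs


F-suc-mono : ∀ n → F n ≤ F (suc n)
F-suc-mono zero = z≤n
F-suc-mono (suc zero) = ≤-refl
F-suc-mono (suc (suc n)) = m≤m+n _ _

F-mono : ∀ {m n} → m ≤ n → F m ≤ F n
F-mono m≤n = go (≤⇒≤′ m≤n)
  where
  go : ∀ {m n} → m ≤′ n → F m ≤ F n
  go ≤′-refl = ≤-refl
  go (≤′-step {n} m≤′n) = ≤-trans (go m≤′n) (F-suc-mono n)

F-suc-pos : ∀ n → 1 ≤ F (suc n)
F-suc-pos n = F-mono {1} {suc n} (s≤s z≤n)

F-add : ∀ m n → F (suc (m + n)) ≡ F (suc m) * F (suc n) + F m * F n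
F-add zero n = unit (F (suc n)) (F n)
  where
  unit : ∀ v u → v ≡ 1 * v + 0 * u
  unit = solve-∀
F-add (suc zero) n = units (F (suc n)) (F n)
  where
  units : ∀ v u → v + u ≡ 1 * v + 1 * u
  units = solve-∀
F-add (suc (suc m)) n =
  trans (cong₂ _+_ (F-add (suc m) n) (F-add m n))
        (regroup (F (suc (suc m))) (F (suc m)) (F m) (F (suc n)) (F n))
  where
  regroup : ∀ x y z u v → (x * u + y * v) + (y * u + z * v) ≡ (x + y) * u + (y + z) * v
  regroup = solve-∀

cassini : ∀ n → F (suc n) * F (suc n) ≡ F n * F n + F n * F (suc n) + 1
              ⊎ F (suc n) * F (suc n) + 1 ≡ F n * F n + F n * F (suc n)
cassini zero = inj₁ refl
cassini (suc n) with cassini n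
... | inj₁ even = inj₂ (flip₁ (F n) (F (suc n)) even)
  where
  flip₁ : ∀ u v → v * v ≡ u * u + u * v + 1 → (v + u) * (v + u) + 1 ≡ v * v + v * (v + u)
  flip₁ u v h = trans (expand u v) (trans (cong (λ t → v * v + v * u + t) (sym h)) (collect u v))
    where
    expand : ∀ u v → (v + u) * (v + u) + 1 ≡ v * v + v * u + (u * u + u * v + 1)
    expand = solve-∀
    collect : ∀ u v → v * v + v * u + v * v ≡ v * v + v * (v + u)
    collect = solve-∀
... | inj₂ odd = inj₁ (flip₂ (F n) (F (suc n)) odd)
  where
  flip₂ : ∀ u v → v * v + 1 ≡ u * u + u * v → (v + u) * (v + u) ≡ v * v + v * (v + u) + 1
  flip₂ u v h = trans (expand u v) (trans (cong (λ t → v * v + v * u + t) (sym h)) (collect u v))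
    where
    expand : ∀ u v → (v + u) * (v + u) ≡ v * v + v * u + (u * u + u * v)
    expand = solve-∀
    collect : ∀ u v → v * v + v * u + (v * v + 1) ≡ v * v + v * (v + u) + 1
    collect = solve-∀

cassini-≤ : ∀ n → F (suc n) * F (suc n) ≤ F n * F n + F n * F (suc n) + 1
cassini-≤ n with cassini n
... | inj₁ even = ≤-reflexive even
... | inj₂ odd = ≤-trans (m≤m+n _ 1) (≤-trans (≤-reflexive odd) (m≤m+n _ 1))

cassini-≥ : ∀ n → F n * F n + F n * F (suc n) ≤ F (suc n) * F (suc n) + 1
cassini-≥ n with cassini n
... | inj₁ even = ≤-trans (m≤m+n _ 1) (≤-trans (≤-reflexive (sym even)) (m≤m+n _ 1))
... | inj₂ odd = ≤-reflexive (sym odd)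


-- Linear inequalities between Gibonacci sequences

Gibonacci : (ℕ → ℕ) → Set
Gibonacci f = ∀ n → f (suc (suc n)) ≡ f (suc n) + f n

gibonacci-≤ : ∀ {f g} s n₀ → Gibonacci f → Gibonacci g →
  f n₀ + s ≤ g n₀ → f (suc n₀) + s ≤ g (suc n₀) → ∀ {n} → n₀ ≤ n → f n + s ≤ g n
gibonacci-≤ {f} {g} s n₀ gib-f gib-g base₀ base₁ n₀≤n = proj₁ (go (≤⇒≤′ n₀≤n))
  where
  open ≤-Reasoning
  Holds : ℕ → Set
  Holds n = f n + s ≤ g n
  go : ∀ {n} → n₀ ≤′ n → Holds n × Holds (suc n)
  go ≤′-refl = base₀ , base₁
  go (≤′-step {n} n₀≤′n) with go n₀≤′n
  ... | holds , holds-suc = holds-suc , (begin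
    f (suc (suc n)) + s         ≡⟨ cong (_+ s) (gib-f n) ⟩
    f (suc n) + f n + s         ≤⟨ m≤m+n _ s ⟩
    f (suc n) + f n + s + s     ≡⟨ regroup (f (suc n)) (f n) s ⟩
    (f (suc n) + s) + (f n + s) ≤⟨ +-mono-≤ holds-suc holds ⟩
    g (suc n) + g n             ≡⟨ sym (gib-g n) ⟩
    g (suc (suc n))             ∎)
    where
    regroup : ∀ x y s → x + y + s + s ≡ (x + s) + (y + s)
    regroup = solve-∀

FibCombination : Set
FibCombination = List (ℕ × ℕ)

-- Singletons get their own clause so that instances are definitionally the expected
-- sums, without a trailing + 0.
⟦_⟧ : FibCombination → ℕ → ℕ
⟦ [] ⟧ n = 0
⟦ (α , i) ∷ [] ⟧ n = α * F (i + n)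
⟦ (α , i) ∷ t ∷ ts ⟧ n = α * F (i + n) + ⟦ t ∷ ts ⟧ n

F-shift-gibonacci : ∀ i → Gibonacci (λ n → F (i + n))
F-shift-gibonacci i n rewrite +-suc i (suc n) | +-suc i n = refl

⟦⟧-gibonacci : ∀ ts → Gibonacci ⟦ ts ⟧
⟦⟧-gibonacci [] n = refl
⟦⟧-gibonacci ((α , i) ∷ []) n =
  trans (cong (α *_) (F-shift-gibonacci i n)) (*-distribˡ-+ α _ _)
⟦⟧-gibonacci ((α , i) ∷ t ∷ ts) n =
  trans (cong₂ _+_ (⟦⟧-gibonacci [ (α , i) ] n) (⟦⟧-gibonacci (t ∷ ts) n))
        (interchange (α * F (i + suc n)) (α * F (i + n)) (⟦ t ∷ ts ⟧ (suc n)) (⟦ t ∷ ts ⟧ n))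
  where
  interchange : ∀ a b c d → (a + b) + (c + d) ≡ (a + c) + (b + d)
  interchange = solve-∀

⟦⟧-≤ : ∀ f g s n₀ →
  T (⟦ f ⟧ n₀ + s ≤ᵇ ⟦ g ⟧ n₀) → T (⟦ f ⟧ (suc n₀) + s ≤ᵇ ⟦ g ⟧ (suc n₀)) →
  ∀ {n} → n₀ ≤ n → ⟦ f ⟧ n + s ≤ ⟦ g ⟧ n
⟦⟧-≤ f g s n₀ check₀ check₁ =
  gibonacci-≤ {⟦ f ⟧} {⟦ g ⟧} s n₀ (⟦⟧-gibonacci f) (⟦⟧-gibonacci g) (≤ᵇ⇒≤ _ _ check₀) (≤ᵇ⇒≤ _ _ check₁)

⟦⟧-≤₀ : ∀ f g n₀ →
  T (⟦ f ⟧ n₀ ≤ᵇ ⟦ g ⟧ n₀) → T (⟦ f ⟧ (suc n₀) ≤ᵇ ⟦ g ⟧ (suc n₀)) →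
  ∀ {n} → n₀ ≤ n → ⟦ f ⟧ n ≤ ⟦ g ⟧ n
⟦⟧-≤₀ f g n₀ check₀ check₁ {n} n₀≤n =
  subst (_≤ ⟦ g ⟧ n) (+-identityʳ (⟦ f ⟧ n))
    (⟦⟧-≤ f g 0 n₀ (add-zero n₀ check₀) (add-zero (suc n₀) check₁) n₀≤n)
  where
  add-zero : ∀ k → T (⟦ f ⟧ k ≤ᵇ ⟦ g ⟧ k) → T (⟦ f ⟧ k + 0 ≤ᵇ ⟦ g ⟧ k)
  add-zero k = subst (λ t → T (t ≤ᵇ ⟦ g ⟧ k)) (sym (+-identityʳ (⟦ f ⟧ k)))

F-suc≥3/2 : ∀ {n} → 2 ≤ n → 3 * F n ≤ 2 * F (suc n)
F-suc≥3/2 = ⟦⟧-≤₀ [ (3 , 0) ] [ (2 , 1) ] 2 tt tt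

F-suc≥8/5 : ∀ {n} → 4 ≤ n → 8 * F n ≤ 5 * F (suc n)
F-suc≥8/5 = ⟦⟧-≤₀ [ (8 , 0) ] [ (5 , 1) ] 4 tt tt

F-suc≥21/13 : ∀ {n} → 7 ≤ n → 21 * F n ≤ 13 * F (suc n)
F-suc≥21/13 = ⟦⟧-≤₀ [ (21 , 0) ] [ (13 , 1) ] 7 tt tt

F-suc≤2 : ∀ {n} → 1 ≤ n → 1 * F (suc n) ≤ 2 * F n
F-suc≤2 = ⟦⟧-≤₀ [ (1 , 1) ] [ (2 , 0) ] 1 tt tt

F-suc≤5/3 : ∀ {n} → 4 ≤ n → 3 * F (suc n) ≤ 5 * F n
F-suc≤5/3 = ⟦⟧-≤₀ [ (3 , 1) ] [ (5 , 0) ] 4 tt tt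

F-suc≤34/21 : ∀ {n} → 7 ≤ n → 21 * F (suc n) ≤ 34 * F n
F-suc≤34/21 = ⟦⟧-≤₀ [ (21 , 1) ] [ (34 , 0) ] 7 tt tt


≤-larger-summand : ∀ {a b} k → a ≤ b → k + k ≤ suc (a + b) → k ≤ b
≤-larger-summand {a} {b} k a≤b 2k≤a+b+1 with k ≤? b
... | yes k≤b = k≤b
... | no k≰b = ⊥-elim (<⇒≱ a+b+1<2k 2k≤a+b+1)
  where
  open ≤-Reasoning
  b<k : b < k
  b<k = ≰⇒> k≰b
  a+b+1<2k : suc (a + b) < k + k
  a+b+1<2k = begin-strict
    suc (a + b)          ≤⟨ s≤s (+-monoˡ-≤ b a≤b) ⟩
    suc (b + b)          <⟨ n<1+n _ ⟩
    suc (suc (b + b))    ≡⟨ cong suc (sym (+-suc b b)) ⟩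
    suc b + suc b        ≤⟨ +-mono-≤ b<k b<k ⟩
    k + k                ∎

m*n+o≤m*[n+o] : ∀ {x} y z → 1 ≤ x → x * y + z ≤ x * (y + z)
m*n+o≤m*[n+o] {x} y z 1≤x = begin
  x * y + z        ≤⟨ +-monoʳ-≤ (x * y) (m≤n*m z x) ⟩
  x * y + x * z    ≡⟨ sym (*-distribˡ-+ x y z) ⟩
  x * (y + z)      ∎
  where
  open ≤-Reasoning
  instance
    _ : NonZero x
    _ = >-nonZero 1≤x

F-add-mono : ∀ {α β} a n → α ≤ F (suc a) → β ≤ F a →
  α * F (suc n) + β * F n ≤ F (suc (a + n))
F-add-mono a n α≤ β≤ =
  ≤-trans (+-mono-≤ (*-monoˡ-≤ (F (suc n)) α≤) (*-monoˡ-≤ (F n) β≤)) (≤-reflexive (sym (F-add a n)))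

F*F≤F-add : ∀ a n → F a * F n ≤ F (suc (a + n))
F*F≤F-add a n = ≤-trans (m≤n+m _ _) (≤-reflexive (sym (F-add a n)))

F-add-scaled : ∀ ρ a n → ρ * F (suc (a + n)) ≡ ρ * F (suc a) * F (suc n) + ρ * (F a * F n)
F-add-scaled ρ a n = trans (cong (ρ *_) (F-add a n)) (distrib ρ (F (suc a)) (F (suc n)) (F a * F n))
  where
  distrib : ∀ ρ y v w → ρ * (y * v + w) ≡ ρ * y * v + ρ * w
  distrib = solve-∀

F-combination-scaled : ∀ ρ₁ ρ₂ a n →
  F a * (ρ₁ * F (suc n) + ρ₂ * F n) ≡ ρ₁ * F a * F (suc n) + ρ₂ * (F a * F n)
F-combination-scaled ρ₁ ρ₂ a n = spread (F a) ρ₁ ρ₂ (F (suc n)) (F n)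
  where
  spread : ∀ x p q v u → x * (p * v + q * u) ≡ p * x * v + q * (x * u)
  spread = solve-∀

F-add-≥ : ∀ ρ₁ ρ₂ a n → ρ₁ * F a ≤ ρ₂ * F (suc a) →
  F a * (ρ₁ * F (suc n) + ρ₂ * F n) ≤ ρ₂ * F (suc (a + n))
F-add-≥ ρ₁ ρ₂ a n ratio = begin
  F a * (ρ₁ * F (suc n) + ρ₂ * F n)                ≡⟨ F-combination-scaled ρ₁ ρ₂ a n ⟩
  ρ₁ * F a * F (suc n) + ρ₂ * (F a * F n)          ≤⟨ +-monoˡ-≤ _ (*-monoˡ-≤ (F (suc n)) ratio) ⟩
  ρ₂ * F (suc a) * F (suc n) + ρ₂ * (F a * F n)    ≡⟨ sym (F-add-scaled ρ₂ a n) ⟩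
  ρ₂ * F (suc (a + n))                             ∎
  where open ≤-Reasoning

F-add-≤ : ∀ ρ₁ ρ₂ a n → ρ₂ * F (suc a) ≤ ρ₁ * F a →
  ρ₂ * F (suc (a + n)) ≤ F a * (ρ₁ * F (suc n) + ρ₂ * F n)
F-add-≤ ρ₁ ρ₂ a n ratio = begin
  ρ₂ * F (suc (a + n))                             ≡⟨ F-add-scaled ρ₂ a n ⟩
  ρ₂ * F (suc a) * F (suc n) + ρ₂ * (F a * F n)    ≤⟨ +-monoˡ-≤ _ (*-monoˡ-≤ (F (suc n)) ratio) ⟩
  ρ₁ * F a * F (suc n) + ρ₂ * (F a * F n)          ≡⟨ sym (F-combination-scaled ρ₁ ρ₂ a n) ⟩
  F a * (ρ₁ * F (suc n) + ρ₂ * F n)                ∎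
  where open ≤-Reasoning

F-product-≤-F-add : ∀ ρ₁ ρ₂ k s r a b n .{{_ : NonZero ρ₂}} →
  1 ≤ F a → ρ₁ * F a ≤ ρ₂ * F (suc a) →
  ρ₂ * k * F b + ρ₂ * s ≤ r * ρ₁ * F (suc n) + r * ρ₂ * F n →
  k * F a * F b + s ≤ r * F (suc (a + n))
F-product-≤-F-add ρ₁ ρ₂ k s r a b n 1≤Fa ratio linear = *-cancelˡ-≤ ρ₂ (begin
  ρ₂ * (k * F a * F b + s)                          ≡⟨ e₁ ρ₂ k s (F a) (F b) ⟩
  F a * (ρ₂ * k * F b) + ρ₂ * s                     ≤⟨ m*n+o≤m*[n+o] _ _ 1≤Fa ⟩
  F a * (ρ₂ * k * F b + ρ₂ * s)                     ≤⟨ *-monoʳ-≤ (F a) linear ⟩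
  F a * (r * ρ₁ * F (suc n) + r * ρ₂ * F n)         ≡⟨ e₂ r ρ₁ ρ₂ (F a) (F (suc n)) (F n) ⟩
  r * (F a * (ρ₁ * F (suc n) + ρ₂ * F n))           ≤⟨ *-monoʳ-≤ r (F-add-≥ ρ₁ ρ₂ a n ratio) ⟩
  r * (ρ₂ * F (suc (a + n)))                        ≡⟨ *-comm-middle r ρ₂ (F (suc (a + n))) ⟩
  ρ₂ * (r * F (suc (a + n)))                        ∎)
  where
  open ≤-Reasoning
  e₁ : ∀ q k s x y → q * (k * x * y + s) ≡ x * (q * k * y) + q * s
  e₁ = solve-∀
  e₂ : ∀ r p q x v u → x * (r * p * v + r * q * u) ≡ r * (x * (p * v + q * u))
  e₂ = solve-∀
  *-comm-middle : ∀ r q z → r * (q * z) ≡ q * (r * z)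
  *-comm-middle = solve-∀

F-add-≤-F-product : ∀ ρ₁ ρ₂ k s r a b n .{{_ : NonZero ρ₂}} →
  1 ≤ F a → ρ₂ * F (suc a) ≤ ρ₁ * F a →
  r * ρ₁ * F (suc n) + r * ρ₂ * F n + ρ₂ * s ≤ ρ₂ * k * F b →
  r * F (suc (a + n)) + s ≤ k * F a * F b
F-add-≤-F-product ρ₁ ρ₂ k s r a b n 1≤Fa ratio linear = *-cancelˡ-≤ ρ₂ (begin
  ρ₂ * (r * F (suc (a + n)) + s)                    ≡⟨ e₁ ρ₂ r s (F (suc (a + n))) ⟩
  r * (ρ₂ * F (suc (a + n))) + ρ₂ * s               ≤⟨ +-monoˡ-≤ _ (*-monoʳ-≤ r (F-add-≤ ρ₁ ρ₂ a n ratio)) ⟩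
  r * (F a * (ρ₁ * F (suc n) + ρ₂ * F n)) + ρ₂ * s  ≡⟨ cong (_+ ρ₂ * s) (e₂ r ρ₁ ρ₂ (F a) (F (suc n)) (F n)) ⟩
  F a * (r * ρ₁ * F (suc n) + r * ρ₂ * F n) + ρ₂ * s ≤⟨ m*n+o≤m*[n+o] _ _ 1≤Fa ⟩
  F a * (r * ρ₁ * F (suc n) + r * ρ₂ * F n + ρ₂ * s) ≤⟨ *-monoʳ-≤ (F a) linear ⟩
  F a * (ρ₂ * k * F b)                              ≡⟨ e₃ ρ₂ k (F a) (F b) ⟩
  ρ₂ * (k * F a * F b)                              ∎)
  where
  open ≤-Reasoning
  e₁ : ∀ q r s z → q * (r * z + s) ≡ r * (q * z) + q * s
  e₁ = solve-∀
  e₂ : ∀ r p q x v u → r * (x * (p * v + q * u)) ≡ x * (r * p * v + r * q * u)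
  e₂ = solve-∀
  e₃ : ∀ q k x y → x * (q * k * y) ≡ q * (k * x * y)
  e₃ = solve-∀

F-add<3*F*F : ∀ {a b} → 1 ≤ a → 3 ≤ b → F (a + b) < 3 * F a * F b
F-add<3*F*F {suc a} {b} _ 3≤b = begin-strict
  F (suc a + b)                          <⟨ m<m+n _ (F-suc-pos a) ⟩
  F (suc a + b) + X                      ≡⟨ cong (_+ X) (F-add a b) ⟩
  X * F (suc b) + F a * Y + X            ≤⟨ +-monoˡ-≤ X (+-monoʳ-≤ (X * F (suc b)) (*-monoˡ-≤ Y (F-suc-mono a))) ⟩
  X * F (suc b) + X * Y + X              ≡⟨ regroup X (F (suc b)) Y ⟩
  X * (1 * F (suc b) + 1) + X * Y        ≤⟨ +-monoˡ-≤ (X * Y) (*-monoʳ-≤ X (⟦⟧-≤ [ (1 , 1) ] [ (2 , 0) ] 1 3 tt tt 3≤b)) ⟩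
  X * (2 * Y) + X * Y                    ≡⟨ triple X Y ⟩
  3 * X * Y                              ∎
  where
  open ≤-Reasoning
  X = F (suc a)
  Y = F b
  regroup : ∀ x v y → x * v + x * y + x ≡ x * (1 * v + 1) + x * y
  regroup = solve-∀
  triple : ∀ x y → x * (2 * y) + x * y ≡ 3 * x * y
  triple = solve-∀

minimal⇒a+b<c : ∀ {a b c} → 2 ≤ a → a ≤ b → 5 ≤ c → 3 * F a * F b ≤ F c → a + b < c
minimal⇒a+b<c {a} {b} {c} 2≤a a≤b 5≤c minimal with a + b <? c
... | yes a+b<c = a+b<c
... | no a+b≮c = ⊥-elim (<⇒≱ (F-add<3*F*F (≤-trans (s≤s z≤n) 2≤a) 3≤b) (≤-trans minimal (F-mono c≤a+b)))
  where
  c≤a+b : c ≤ a + b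
  c≤a+b = ≮⇒≥ a+b≮c
  3≤b : 3 ≤ b
  3≤b = ≤-larger-summand 3 a≤b (s≤s (≤-trans 5≤c c≤a+b))

3*F*F≤F-add : ∀ {a b} → 2 ≤ a → 2 ≤ b → 3 * F a * F b ≤ F (suc (a + b))
3*F*F≤F-add {a} {b} 2≤a 2≤b =
  subst₂ _≤_ (+-identityʳ (3 * F a * F b)) (*-identityˡ (F (suc (a + b))))
    (F-product-≤-F-add 3 2 3 0 1 a b b (F-mono {2} 2≤a) (F-suc≥3/2 2≤a)
      (⟦⟧-≤ [ (2 * 3 , 0) ] ((1 * 3 , 1) ∷ [ (1 * 2 , 0) ]) (2 * 0) 2 tt tt 2≤b))


-- A record rather than a bare equation so that unification can read off m, x, y, z.
record MarkoffEquation (m x y z : ℕ) : Set where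
  constructor markoff
  field
    equation : x * x + y * y + z * z ≡ 3 * x * y * z + m

open MarkoffEquation using (equation)

markoff-lower : ∀ p r {X Y Z m} → MarkoffEquation m X Y Z → 1 ≤ Z →
  3 * (p + r) * X * Y + 1 ≤ r * Z → p * (Z * Z) < (p + r) * m
markoff-lower p r {X} {Y} {Z} {m} eq 1≤Z Z-large =
  <-≤-trans (m<m+n (p * (Z * Z)) 1≤Z) (+-cancelʳ-≤ (3 * q * X * Y * Z) _ _ (begin
    p * (Z * Z) + Z + 3 * q * X * Y * Z    ≡⟨ e₁ p r X Y Z ⟩
    p * (Z * Z) + (3 * q * X * Y + 1) * Z  ≤⟨ +-monoʳ-≤ (p * (Z * Z)) (*-monoˡ-≤ Z Z-large) ⟩
    p * (Z * Z) + r * Z * Z                ≡⟨ e₂ p r Z ⟩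
    q * (Z * Z)                            ≤⟨ *-monoʳ-≤ q (m≤n+m (Z * Z) (X * X + Y * Y)) ⟩
    q * (X * X + Y * Y + Z * Z)            ≡⟨ cong (q *_) (equation eq) ⟩
    q * (3 * X * Y * Z + m)                ≡⟨ e₃ p r X Y Z m ⟩
    q * m + 3 * q * X * Y * Z              ∎))
  where
  open ≤-Reasoning
  q = p + r
  e₁ : ∀ p r X Y Z → p * (Z * Z) + Z + 3 * (p + r) * X * Y * Z ≡ p * (Z * Z) + (3 * (p + r) * X * Y + 1) * Z
  e₁ = solve-∀
  e₂ : ∀ p r Z → p * (Z * Z) + r * Z * Z ≡ (p + r) * (Z * Z)
  e₂ = solve-∀
  e₃ : ∀ p r X Y Z m → (p + r) * (3 * X * Y * Z + m) ≡ (p + r) * m + 3 * (p + r) * X * Y * Z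
  e₃ = solve-∀

-- τ x ≤ y z and σ y ≤ x z give x² + y² ≤ (1/τ + 1/σ) x y z, so m ≤ z² − (κ / στ) x y z.
markoff-upper : ∀ p r σ τ κ {X Y Z m} → κ + τ + σ ≡ 3 * σ * τ →
  MarkoffEquation m X Y Z → 1 ≤ Z → σ * Y ≤ X * Z → τ * X ≤ Y * Z →
  σ * τ * r * Z + 1 ≤ κ * (p + r) * X * Y → (p + r) * m < p * (Z * Z)
markoff-upper p r σ τ κ {X} {Y} {Z} {m} κ-def eq 1≤Z σY≤XZ τX≤YZ XY-large =
  *-cancelˡ-< (σ * τ) _ _
    (<-≤-trans (m<m+n (σ * τ * (q * m)) 1≤Z) (+-cancelʳ-≤ W _ _ (begin
      σ * τ * (q * m) + Z + W
        ≡⟨ e₁ p r σ τ X Y Z m ⟩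
      σ * τ * q * (3 * X * Y * Z + m) + (σ * τ * r * Z + 1) * Z
        ≡⟨ cong (λ t → σ * τ * q * t + (σ * τ * r * Z + 1) * Z) (sym (equation eq)) ⟩
      σ * τ * q * (X * X + Y * Y + Z * Z) + (σ * τ * r * Z + 1) * Z
        ≡⟨ cong (_+ (σ * τ * r * Z + 1) * Z) (e₂ q σ τ X Y Z) ⟩
      σ * q * X * (τ * X) + τ * q * Y * (σ * Y) + σ * τ * q * (Z * Z) + (σ * τ * r * Z + 1) * Z
        ≤⟨ +-mono-≤ (+-monoˡ-≤ (σ * τ * q * (Z * Z))
                      (+-mono-≤ (*-monoʳ-≤ (σ * q * X) τX≤YZ) (*-monoʳ-≤ (τ * q * Y) σY≤XZ)))
                    (*-monoˡ-≤ Z XY-large) ⟩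
      σ * q * X * (Y * Z) + τ * q * Y * (X * Z) + σ * τ * q * (Z * Z) + κ * q * X * Y * Z
        ≡⟨ e₃ q σ τ κ X Y Z ⟩
      (κ + τ + σ) * q * X * Y * Z + σ * τ * q * (Z * Z)
        ≡⟨ cong (λ t → t * q * X * Y * Z + σ * τ * q * (Z * Z)) κ-def ⟩
      3 * σ * τ * q * X * Y * Z + σ * τ * q * (Z * Z)
        ≡⟨ e₄ p r σ τ X Y Z ⟩
      σ * τ * (p * (Z * Z)) + W
        ∎)))
  where
  open ≤-Reasoning
  q = p + r
  W = 3 * σ * τ * q * X * Y * Z + σ * τ * r * Z * Z
  e₁ : ∀ p r σ τ X Y Z m →
    σ * τ * ((p + r) * m) + Z + (3 * σ * τ * (p + r) * X * Y * Z + σ * τ * r * Z * Z)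
      ≡ σ * τ * (p + r) * (3 * X * Y * Z + m) + (σ * τ * r * Z + 1) * Z
  e₁ = solve-∀
  e₂ : ∀ q σ τ X Y Z →
    σ * τ * q * (X * X + Y * Y + Z * Z) ≡ σ * q * X * (τ * X) + τ * q * Y * (σ * Y) + σ * τ * q * (Z * Z)
  e₂ = solve-∀
  e₃ : ∀ q σ τ κ X Y Z →
    σ * q * X * (Y * Z) + τ * q * Y * (X * Z) + σ * τ * q * (Z * Z) + κ * q * X * Y * Z
      ≡ (κ + τ + σ) * q * X * Y * Z + σ * τ * q * (Z * Z)
  e₃ = solve-∀
  e₄ : ∀ p r σ τ X Y Z →
    3 * σ * τ * (p + r) * X * Y * Z + σ * τ * (p + r) * (Z * Z)
      ≡ σ * τ * (p * (Z * Z)) + (3 * σ * τ * (p + r) * X * Y * Z + σ * τ * r * Z * Z)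
  e₄ = solve-∀

markoff-m+z≤z*z : ∀ {m X Y Z} → MarkoffTriple m X Y Z → m + Z ≤ Z * Z
markoff-m+z≤z*z {m} {X} {Y} {Z} (1≤X , X≤Y , Y≤Z , eq) = +-cancelʳ-≤ (3 * X * Y * Z) _ _ (begin
  m + Z + 3 * X * Y * Z                        ≡⟨ e₁ m Z (3 * X * Y * Z) ⟩
  3 * X * Y * Z + m + Z                        ≡⟨ cong (_+ Z) (sym eq) ⟩
  X * X + Y * Y + Z * Z + Z                    ≡⟨ e₂ (X * X) (Y * Y) (Z * Z) Z ⟩
  (X * X + Y * Y + Z) + Z * Z                  ≤⟨ +-monoˡ-≤ (Z * Z) (+-mono-≤ (+-mono-≤ X*X≤ Y*Y≤) Z≤) ⟩
  (X * Y * Z + X * Y * Z + X * Y * Z) + Z * Z  ≡⟨ e₃ X Y Z ⟩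
  Z * Z + 3 * X * Y * Z                        ∎)
  where
  open ≤-Reasoning
  1≤Y = ≤-trans 1≤X X≤Y
  1≤Z = ≤-trans 1≤Y Y≤Z
  X*X≤ : X * X ≤ X * Y * Z
  X*X≤ = ≤-trans (*-monoʳ-≤ X X≤Y) (subst (_≤ X * Y * Z) (*-identityʳ (X * Y)) (*-monoʳ-≤ (X * Y) 1≤Z))
  Y*Y≤ : Y * Y ≤ X * Y * Z
  Y*Y≤ = ≤-trans (*-monoʳ-≤ Y Y≤Z) (subst (_≤ X * Y * Z) (cong (_* Z) (*-identityˡ Y)) (*-monoˡ-≤ Z (*-monoˡ-≤ Y 1≤X)))
  Z≤ : Z ≤ X * Y * Z
  Z≤ = subst (_≤ X * Y * Z) (*-identityˡ Z) (*-monoˡ-≤ Z (*-mono-≤ 1≤X 1≤Y))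
  e₁ : ∀ m z k → m + z + k ≡ k + m + z
  e₁ = solve-∀
  e₂ : ∀ a b c d → a + b + c + d ≡ (a + b + d) + c
  e₂ = solve-∀
  e₃ : ∀ X Y Z → (X * Y * Z + X * Y * Z + X * Y * Z) + Z * Z ≡ Z * Z + 3 * X * Y * Z
  e₃ = solve-∀

m+n≤n*n-mono : ∀ {m z w} → m + z ≤ z * z → z ≤ w → m + w ≤ w * w
m+n≤n*n-mono {m} m+z≤z*z z≤w = go (≤⇒≤′ z≤w)
  where
  open ≤-Reasoning
  go : ∀ {w} → _ ≤′ w → m + w ≤ w * w
  go ≤′-refl = m+z≤z*z
  go (≤′-step {w} z≤′w) = begin
    m + suc w              ≡⟨ +-suc m w ⟩
    suc (m + w)            ≤⟨ s≤s (go z≤′w) ⟩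
    suc (w * w)            ≤⟨ s≤s (*-monoʳ-≤ w (n≤1+n w)) ⟩
    suc (w * suc w)        ≤⟨ s≤s (m≤n+m _ w) ⟩
    suc w * suc w          ∎

-- With u = F e, v = F (suc e) and z = v + u: m = x² + y² + z (z − 3xy) ≥ 2 + z u ≥ v² + 1,
-- the last step by Cassini.
markoff-F[c-1]²<m : ∀ e {X Y m} → 1 ≤ X → 1 ≤ Y → 3 * X * Y ≤ F (suc e) →
  MarkoffEquation m X Y (F (suc (suc e))) → F (suc e) * F (suc e) < m
markoff-F[c-1]²<m e {X} {Y} {m} 1≤X 1≤Y 3XY≤v eq = +-cancelʳ-≤ (3 * X * Y * (v + u)) _ _ (begin
  suc (v * v) + 3 * X * Y * (v + u)                ≤⟨ +-monoˡ-≤ (3 * X * Y * (v + u)) (s≤s (cassini-≤ e)) ⟩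
  suc (u * u + u * v + 1) + 3 * X * Y * (v + u)    ≡⟨ e₁ u v (3 * X * Y) ⟩
  u * (v + u) + 2 + 3 * X * Y * (v + u)            ≤⟨ +-mono-≤ (+-monoʳ-≤ (u * (v + u)) 2≤X²+Y²) (*-monoˡ-≤ (v + u) 3XY≤v) ⟩
  u * (v + u) + (X * X + Y * Y) + v * (v + u)      ≡⟨ e₂ u v (X * X + Y * Y) ⟩
  X * X + Y * Y + (v + u) * (v + u)                ≡⟨ equation eq ⟩
  3 * X * Y * (v + u) + m                          ≡⟨ +-comm _ m ⟩
  m + 3 * X * Y * (v + u)                          ∎)
  where
  open ≤-Reasoning
  u = F e
  v = F (suc e)
  2≤X²+Y² : 2 ≤ X * X + Y * Y
  2≤X²+Y² = +-mono-≤ (*-mono-≤ 1≤X 1≤X) (*-mono-≤ 1≤Y 1≤Y)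
  e₁ : ∀ u v k → suc (u * u + u * v + 1) + k * (v + u) ≡ u * (v + u) + 2 + k * (v + u)
  e₁ = solve-∀
  e₂ : ∀ u v s → u * (v + u) + s + v * (v + u) ≡ s + (v + u) * (v + u)
  e₂ = solve-∀


-- Quadratic forms in (F n , F (suc n))

record QuadraticForm : Set where
  constructor form
  field
    uu uv vv : ℕ

open QuadraticForm using (vv)

infixl 6 _⊕_
infixr 7 _⊙_
infix 5 _at_

_⊕_ : QuadraticForm → QuadraticForm → QuadraticForm
form A B C ⊕ form A′ B′ C′ = form (A + A′) (B + B′) (C + C′)

_⊙_ : ℕ → QuadraticForm → QuadraticForm
k ⊙ form A B C = form (k * A) (k * B) (k * C)

_at_ : QuadraticForm → ℕ → ℕ
form A B C at n = A * (F n * F n) + B * (F n * F (suc n)) + C * (F (suc n) * F (suc n))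

⊕-at : ∀ f g n → (f ⊕ g at n) ≡ (f at n) + (g at n)
⊕-at (form A B C) (form A′ B′ C′) n = distrib A B C A′ B′ C′ (F n * F n) (F n * F (suc n)) (F (suc n) * F (suc n))
  where
  distrib : ∀ A B C A′ B′ C′ x y z →
    (A + A′) * x + (B + B′) * y + (C + C′) * z ≡ (A * x + B * y + C * z) + (A′ * x + B′ * y + C′ * z)
  distrib = solve-∀

⊙-at : ∀ k f n → (k ⊙ f at n) ≡ k * (f at n)
⊙-at k (form A B C) n = distrib k A B C (F n * F n) (F n * F (suc n)) (F (suc n) * F (suc n))
  where
  distrib : ∀ k A B C x y z → k * A * x + k * B * y + k * C * z ≡ k * (A * x + B * y + C * z)
  distrib = solve-∀

u² : QuadraticForm
u² = form 1 0 0

u²-at : ∀ n → (u² at n) ≡ F n * F n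
u²-at n = unit (F n * F n) (F n * F (suc n)) (F (suc n) * F (suc n))
  where
  unit : ∀ x y z → 1 * x + 0 * y + 0 * z ≡ x
  unit = solve-∀

shift² : ℕ → QuadraticForm
shift² t = form (F t * F t) (2 * F t * F (suc t)) (F (suc t) * F (suc t))

shift²-at : ∀ t n → (shift² t at n) ≡ F (suc t + n) * F (suc t + n)
shift²-at t n rewrite F-add t n = square (F t) (F (suc t)) (F n) (F (suc n))
  where
  square : ∀ a b u v → a * a * (u * u) + 2 * a * b * (u * v) + b * b * (v * v) ≡ (b * v + a * u) * (b * v + a * u)
  square = solve-∀

u·shift : ℕ → QuadraticForm
u·shift s = form (F s) (F (suc s)) 0

u·shift-at : ∀ s n → (u·shift s at n) ≡ F n * F (suc s + n)
u·shift-at s n rewrite F-add s n = product (F s) (F (suc s)) (F n) (F (suc n))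
  where
  product : ∀ a b u v → a * (u * u) + b * (u * v) + 0 * (v * v) ≡ u * (b * v + a * u)
  product = solve-∀

cassini-at-≤ : ∀ A B C n → (form A B C at n) ≤ F n * ((A + C) * F n + (B + C) * F (suc n)) + C
cassini-at-≤ A B C n = begin
  A * (u * u) + B * (u * v) + C * (v * v)                ≤⟨ +-monoʳ-≤ _ (*-monoʳ-≤ C (cassini-≤ n)) ⟩
  A * (u * u) + B * (u * v) + C * (u * u + u * v + 1)    ≡⟨ collect A B C u v ⟩
  u * ((A + C) * u + (B + C) * v) + C                    ∎
  where
  open ≤-Reasoning
  u = F n
  v = F (suc n)
  collect : ∀ A B C u v → A * (u * u) + B * (u * v) + C * (u * u + u * v + 1) ≡ u * ((A + C) * u + (B + C) * v) + C
  collect = solve-∀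

cassini-at-≥ : ∀ A B C n → F n * ((A + C) * F n + (B + C) * F (suc n)) ≤ (form A B C at n) + C
cassini-at-≥ A B C n = begin
  u * ((A + C) * u + (B + C) * v)                        ≡⟨ collect A B C u v ⟩
  A * (u * u) + B * (u * v) + C * (u * u + u * v)        ≤⟨ +-monoʳ-≤ _ (*-monoʳ-≤ C (cassini-≥ n)) ⟩
  A * (u * u) + B * (u * v) + C * (v * v + 1)            ≡⟨ split A B C u v ⟩
  A * (u * u) + B * (u * v) + C * (v * v) + C            ∎
  where
  open ≤-Reasoning
  u = F n
  v = F (suc n)
  collect : ∀ A B C u v → u * ((A + C) * u + (B + C) * v) ≡ A * (u * u) + B * (u * v) + C * (u * u + u * v)
  collect = solve-∀
  split : ∀ A B C u v → A * (u * u) + B * (u * v) + C * (v * v + 1) ≡ A * (u * u) + B * (u * v) + C * (v * v) + C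
  split = solve-∀

linear-part : QuadraticForm → FibCombination
linear-part (form A B C) = (A + C , 0) ∷ [ (B + C , 1) ]

-- By Cassini f at n ≈ F n · ⟦ linear-part f ⟧ n, so comparing linear parts with slack s
-- compares the forms once s · F n exceeds the accumulated ±1 errors.
QuadraticCheck : QuadraticForm → ℕ → QuadraticForm → ℕ → ℕ → ℕ → Set
QuadraticCheck f K g K′ s n₀ =
  T (⟦ linear-part f ⟧ n₀ + s ≤ᵇ ⟦ linear-part g ⟧ n₀) ×
  T (⟦ linear-part f ⟧ (suc n₀) + s ≤ᵇ ⟦ linear-part g ⟧ (suc n₀)) ×
  T (vv f + vv g + K <ᵇ s * F n₀)

at-< : ∀ f K g K′ s n₀ → QuadraticCheck f K g K′ s n₀ →
  ∀ {n} → n₀ ≤ n → (f at n) + K < (g at n) + K′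
at-< f@(form A B C) K g@(form A′ B′ C′) K′ s n₀ (linear₀ , linear₁ , slack) {n} n₀≤n =
  <-≤-trans (+-cancelʳ-< C′ _ _ (begin-strict
    (f at n) + K + C′         ≤⟨ +-monoˡ-≤ C′ (+-monoˡ-≤ K (cassini-at-≤ A B C n)) ⟩
    u * L + C + K + C′        ≡⟨ regroup (u * L) C K C′ ⟩
    u * L + (C + C′ + K)      <⟨ +-monoʳ-< (u * L) (<-≤-trans (<ᵇ⇒< _ _ slack) (*-monoʳ-≤ s (F-mono n₀≤n))) ⟩
    u * L + s * u             ≡⟨ factor u L s ⟩
    u * (L + s)               ≤⟨ *-monoʳ-≤ u (⟦⟧-≤ (linear-part f) (linear-part g) s n₀ linear₀ linear₁ n₀≤n) ⟩
    u * L′                    ≤⟨ cassini-at-≥ A′ B′ C′ n ⟩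
    (g at n) + C′             ∎)) (m≤m+n _ K′)
  where
  open ≤-Reasoning
  u = F n
  L = ⟦ linear-part f ⟧ n
  L′ = ⟦ linear-part g ⟧ n
  regroup : ∀ x c k c′ → x + c + k + c′ ≡ x + (c + c′ + k)
  regroup = solve-∀
  factor : ∀ u L s → u * L + s * u ≡ u * (L + s)
  factor = solve-∀

target-form : ℕ → ℕ → ℕ → ℕ → ℕ → QuadraticForm
target-form X s t p q = p ⊙ shift² t ⊕ (3 * q * X) ⊙ u·shift s

markoff-form : ℕ → ℕ → QuadraticForm
markoff-form s q = q ⊙ (u² ⊕ shift² s)

target-form-at : ∀ X s t p q n →
  (target-form X s t p q at n) ≡ p * (F (suc t + n) * F (suc t + n)) + 3 * q * X * (F n * F (suc s + n))
target-form-at X s t p q n = begin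
  (target-form X s t p q at n)
    ≡⟨ ⊕-at (p ⊙ shift² t) ((3 * q * X) ⊙ u·shift s) n ⟩
  (p ⊙ shift² t at n) + ((3 * q * X) ⊙ u·shift s at n)
    ≡⟨ cong₂ _+_ (⊙-at p (shift² t) n) (⊙-at (3 * q * X) (u·shift s) n) ⟩
  p * (shift² t at n) + 3 * q * X * (u·shift s at n)
    ≡⟨ cong₂ (λ x y → p * x + 3 * q * X * y) (shift²-at t n) (u·shift-at s n) ⟩
  p * (F (suc t + n) * F (suc t + n)) + 3 * q * X * (F n * F (suc s + n))
    ∎
  where open ≡-Reasoning

markoff-form-at : ∀ X s q n →
  (markoff-form s q at n) + q * X * X ≡ q * (X * X + F n * F n + F (suc s + n) * F (suc s + n))
markoff-form-at X s q n = begin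
  (markoff-form s q at n) + q * X * X
    ≡⟨ cong (_+ q * X * X) (trans (⊙-at q (u² ⊕ shift² s) n) (cong (q *_) (⊕-at u² (shift² s) n))) ⟩
  q * ((u² at n) + (shift² s at n)) + q * X * X
    ≡⟨ cong (λ x → q * x + q * X * X) (cong₂ _+_ (u²-at n) (shift²-at s n)) ⟩
  q * (F n * F n + F (suc s + n) * F (suc s + n)) + q * X * X
    ≡⟨ distrib q X (F n * F n) (F (suc s + n) * F (suc s + n)) ⟩
  q * (X * X + F n * F n + F (suc s + n) * F (suc s + n))
    ∎
  where
  open ≡-Reasoning
  distrib : ∀ q X y z → q * (y + z) + q * X * X ≡ q * (X * X + y + z)
  distrib = solve-∀

markoff-scaled : ∀ q {X Y Z m} → MarkoffEquation m X Y Z →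
  q * (X * X + Y * Y + Z * Z) ≡ q * m + 3 * q * X * (Y * Z)
markoff-scaled q {X} {Y} {Z} {m} eq = trans (cong (q *_) (equation eq)) (distrib q X Y Z m)
  where
  distrib : ∀ q X Y Z m → q * (3 * X * Y * Z + m) ≡ q * m + 3 * q * X * (Y * Z)
  distrib = solve-∀

fixed-x-lower : ∀ X s t p q sl n₀ {n m} →
  QuadraticCheck (target-form X s t p q) 0 (markoff-form s q) (q * X * X) sl n₀ → n₀ ≤ n →
  MarkoffEquation m X (F n) (F (suc s + n)) → p * (F (suc t + n) * F (suc t + n)) < q * m
fixed-x-lower X s t p q sl n₀ {n} {m} check n₀≤n eq = +-cancelʳ-< (3 * q * X * (F n * F (suc s + n))) _ _ (begin-strict
  p * (F (suc t + n) * F (suc t + n)) + 3 * q * X * (F n * F (suc s + n))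
    ≡⟨ sym (trans (+-identityʳ _) (target-form-at X s t p q n)) ⟩
  (target-form X s t p q at n) + 0
    <⟨ at-< (target-form X s t p q) 0 (markoff-form s q) (q * X * X) sl n₀ check n₀≤n ⟩
  (markoff-form s q at n) + q * X * X
    ≡⟨ markoff-form-at X s q n ⟩
  q * (X * X + F n * F n + F (suc s + n) * F (suc s + n))
    ≡⟨ markoff-scaled q eq ⟩
  q * m + 3 * q * X * (F n * F (suc s + n))
    ∎)
  where open ≤-Reasoning

fixed-x-upper : ∀ X s t p q sl n₀ {n m} →
  QuadraticCheck (markoff-form s q) (q * X * X) (target-form X s t p q) 0 sl n₀ → n₀ ≤ n →
  MarkoffEquation m X (F n) (F (suc s + n)) → q * m < p * (F (suc t + n) * F (suc t + n))
fixed-x-upper X s t p q sl n₀ {n} {m} check n₀≤n eq = +-cancelʳ-< (3 * q * X * (F n * F (suc s + n))) _ _ (begin-strict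
  q * m + 3 * q * X * (F n * F (suc s + n))
    ≡⟨ sym (markoff-scaled q eq) ⟩
  q * (X * X + F n * F n + F (suc s + n) * F (suc s + n))
    ≡⟨ sym (markoff-form-at X s q n) ⟩
  (markoff-form s q at n) + q * X * X
    <⟨ at-< (markoff-form s q) (q * X * X) (target-form X s t p q) 0 sl n₀ check n₀≤n ⟩
  (target-form X s t p q at n) + 0
    ≡⟨ trans (+-identityʳ _) (target-form-at X s t p q n) ⟩
  p * (F (suc t + n) * F (suc t + n)) + 3 * q * X * (F n * F (suc s + n))
    ∎)
  where open ≤-Reasoning


-- Ratios m / w², in thousandths

-- Records rather than bare inequalities so that unification can read off p, m and w.
record RatioAbove (p m w : ℕ) : Set where
  constructor ratio-above
  field
    above : p * (w * w) < 1000 * m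

record RatioBelow (p m w : ℕ) : Set where
  constructor ratio-below
  field
    below : 1000 * m < p * (w * w)

RatioBetween : ℕ → ℕ → ℕ → ℕ → Set
RatioBetween p q m w = RatioAbove p m w × RatioBelow q m w

ratio-separated : ∀ {p q m w} → T (q ≤ᵇ p) → RatioBelow q m w → RatioAbove p m w → ⊥
ratio-separated {p} {q} {m} {w} q≤p (ratio-below below) (ratio-above above) =
  <-irrefl refl (<-trans below (≤-<-trans (*-monoˡ-≤ (w * w) (≤ᵇ⇒≤ q p q≤p)) above))

above-rescale : ∀ {p m y} q x → q * (x * x) ≤ p * (y * y) → RatioAbove p m y → RatioAbove q m x
above-rescale q x le (ratio-above above) = ratio-above (≤-<-trans le above)

below-rescale : ∀ {p m y} q x → p * (y * y) ≤ q * (x * x) → RatioBelow p m y → RatioBelow q m x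
below-rescale q x le (ratio-below below) = ratio-below (<-≤-trans below le)

above-weaken : ∀ {p m w} q → T (q ≤ᵇ p) → RatioAbove p m w → RatioAbove q m w
above-weaken {p} {w = w} q q≤p = above-rescale q w (*-monoˡ-≤ (w * w) (≤ᵇ⇒≤ q p q≤p))

fixed-x-ratio : ∀ X s t p p′ sl sl′ n₀ {n m} →
  QuadraticCheck (target-form X s t p 1000) 0 (markoff-form s 1000) (1000 * X * X) sl n₀ →
  QuadraticCheck (markoff-form s 1000) (1000 * X * X) (target-form X s t p′ 1000) 0 sl′ n₀ →
  n₀ ≤ n → MarkoffEquation m X (F n) (F (suc s + n)) → RatioBetween p p′ m (F (suc t + n))
fixed-x-ratio X s t p p′ sl sl′ n₀ lower upper n₀≤n eq =
  ratio-above (fixed-x-lower X s t p 1000 sl n₀ lower n₀≤n eq) ,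
  ratio-below (fixed-x-upper X s t p′ 1000 sl′ n₀ upper n₀≤n eq)

square-scale : ∀ ρ₁ ρ₂ p q x y .{{_ : NonZero ρ₁}} →
  ρ₁ * x ≤ ρ₂ * y → p * (ρ₂ * ρ₂) ≤ q * (ρ₁ * ρ₁) → p * (x * x) ≤ q * (y * y)
square-scale ρ₁ ρ₂ p q x y ρ₁x≤ρ₂y constants =
  *-cancelˡ-≤ (ρ₁ * ρ₁) {{m*n≢0 ρ₁ ρ₁}} (begin
    ρ₁ * ρ₁ * (p * (x * x))        ≡⟨ e₁ ρ₁ p x ⟩
    p * ((ρ₁ * x) * (ρ₁ * x))      ≤⟨ *-monoʳ-≤ p (*-mono-≤ ρ₁x≤ρ₂y ρ₁x≤ρ₂y) ⟩
    p * ((ρ₂ * y) * (ρ₂ * y))      ≡⟨ e₂ ρ₂ p y ⟩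
    p * (ρ₂ * ρ₂) * (y * y)        ≤⟨ *-monoˡ-≤ (y * y) constants ⟩
    q * (ρ₁ * ρ₁) * (y * y)        ≡⟨ e₃ ρ₁ q y ⟩
    ρ₁ * ρ₁ * (q * (y * y))        ∎)
  where
  open ≤-Reasoning
  e₁ : ∀ r p x → r * r * (p * (x * x)) ≡ p * ((r * x) * (r * x))
  e₁ = solve-∀
  e₂ : ∀ r p y → p * ((r * y) * (r * y)) ≡ p * (r * r) * (y * y)
  e₂ = solve-∀
  e₃ : ∀ r q y → q * (r * r) * (y * y) ≡ r * r * (q * (y * y))
  e₃ = solve-∀

σ-condition : ∀ {σ₁ x z} σ₂ y → σ₁ ≤ x → σ₂ * y ≤ z → σ₁ * σ₂ * y ≤ x * z
σ-condition {σ₁} {x} {z} σ₂ y σ₁≤x σ₂y≤z =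
  subst (_≤ x * z) (sym (*-assoc σ₁ σ₂ y)) (*-mono-≤ σ₁≤x σ₂y≤z)

τ-condition : ∀ {τ z} x y w → τ ≤ y * w → x * w ≤ z → τ * x ≤ y * z
τ-condition {τ} {z} x y w τ≤yw xw≤z = begin
  τ * x          ≤⟨ *-monoˡ-≤ x τ≤yw ⟩
  y * w * x      ≡⟨ reorder y w x ⟩
  y * (x * w)    ≤⟨ *-monoʳ-≤ y xw≤z ⟩
  y * z          ∎
  where
  open ≤-Reasoning
  reorder : ∀ y w x → y * w * x ≡ y * (x * w)
  reorder = solve-∀


-- Triples with c = a + b + 1 + d ("offset d") and a, b unbounded

offset≥5-above-915 : ∀ {a b m Z} → 2 ≤ a → 2 ≤ b → F (suc (a + (5 + b))) ≤ Z →
  MarkoffEquation m (F a) (F b) Z → RatioAbove 915 m Z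
offset≥5-above-915 {a} {b} 2≤a 2≤b Z≥ eq =
  ratio-above $ markoff-lower 915 85 eq (≤-trans (F-suc-pos (a + (5 + b))) Z≥) (≤-trans
    (F-product-≤-F-add 3 2 (3 * 1000) 1 85 a b (5 + b) (F-mono {2} 2≤a) (F-suc≥3/2 2≤a)
      (⟦⟧-≤ [ (2 * (3 * 1000) , 0) ] ((85 * 3 , 6) ∷ [ (85 * 2 , 5) ]) (2 * 1) 2 tt tt 2≤b))
    (*-monoʳ-≤ 85 Z≥))

offset-2-4-above-520 : ∀ {a b m Z} → 2 ≤ a → 7 ≤ b → F (suc (a + (2 + b))) ≤ Z →
  MarkoffEquation m (F a) (F b) Z → RatioAbove 520 m Z
offset-2-4-above-520 {a} {b} 2≤a 7≤b Z≥ eq =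
  ratio-above $ markoff-lower 520 480 eq (≤-trans (F-suc-pos (a + (2 + b))) Z≥) (≤-trans
    (F-product-≤-F-add 3 2 (3 * 1000) 1 480 a b (2 + b) (F-mono {2} 2≤a) (F-suc≥3/2 2≤a)
      (⟦⟧-≤ [ (2 * (3 * 1000) , 0) ] ((480 * 3 , 3) ∷ [ (480 * 2 , 2) ]) (2 * 1) 7 tt tt 7≤b))
    (*-monoʳ-≤ 480 Z≥))

offset-2-4-below-906 : ∀ {a b m Z} → 2 ≤ a → 7 ≤ b → F (suc (a + (2 + b))) ≤ Z → Z ≤ F (suc (a + (4 + b))) →
  MarkoffEquation m (F a) (F b) Z → RatioBelow 906 m Z
offset-2-4-below-906 {a} {b} {Z = Z} 2≤a 7≤b Z≥ Z≤ eq =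
  ratio-below $ markoff-upper 906 94 10 442 12808 refl eq (≤-trans (F-suc-pos (a + (2 + b))) Z≥) σY≤XZ τX≤YZ XY-large
  where
  σY≤XZ : 10 * F b ≤ F a * Z
  σY≤XZ = σ-condition 10 (F b) (F-mono {2} 2≤a) (≤-trans
    (⟦⟧-≤₀ [ (10 , 0) ] ((2 , 3) ∷ [ (1 , 2) ]) 2 tt tt (≤-trans (≤ᵇ⇒≤ 2 7 tt) 7≤b))
    (≤-trans (F-add-mono a (2 + b) (F-mono {3} (s≤s 2≤a)) (F-mono {2} 2≤a)) Z≥))
  τX≤YZ : 442 * F a ≤ F b * Z
  τX≤YZ = τ-condition (F a) (F b) (F (2 + b)) (*-mono-≤ (F-mono {7} 7≤b) (F-mono {9} (s≤s (s≤s 7≤b))))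
    (≤-trans (F*F≤F-add a (2 + b)) Z≥)
  XY-large : 10 * 442 * 94 * Z + 1 ≤ 12808 * 1000 * F a * F b
  XY-large = ≤-trans (+-monoˡ-≤ 1 (*-monoʳ-≤ (10 * 442 * 94) Z≤))
    (F-add-≤-F-product 2 1 (12808 * 1000) 1 (10 * 442 * 94) a b (4 + b) (F-mono {2} 2≤a) (F-suc≤2 (≤-trans (s≤s z≤n) 2≤a))
      (⟦⟧-≤ ((10 * 442 * 94 * 2 , 5) ∷ [ (10 * 442 * 94 * 1 , 4) ]) [ (1 * (12808 * 1000) , 0) ] (1 * 1) 7 tt tt 7≤b))

offset-1-above-460 : ∀ {a b m} → 4 ≤ a → 9 ≤ b →
  MarkoffEquation m (F a) (F b) (F (suc (a + (1 + b)))) → RatioAbove 460 m (F (suc (a + (1 + b))))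
offset-1-above-460 {a} {b} 4≤a 9≤b eq =
  ratio-above $ markoff-lower 460 540 eq (F-suc-pos (a + (1 + b)))
    (F-product-≤-F-add 8 5 (3 * 1000) 1 540 a b (1 + b) (F-mono {2} (≤-trans (≤ᵇ⇒≤ 2 4 tt) 4≤a)) (F-suc≥8/5 4≤a)
      (⟦⟧-≤ [ (5 * (3 * 1000) , 0) ] ((540 * 8 , 2) ∷ [ (540 * 5 , 1) ]) (5 * 1) 9 tt tt 9≤b))

offset-1-below-508 : ∀ {a b m} → 4 ≤ a → 9 ≤ b →
  MarkoffEquation m (F a) (F b) (F (suc (a + (1 + b)))) → RatioBelow 508 m (F (suc (a + (1 + b))))
offset-1-below-508 {a} {b} 4≤a 9≤b eq =
  ratio-below $ markoff-upper 508 492 51 1156 175661 refl eq (F-suc-pos (a + (1 + b))) σY≤XZ τX≤YZ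
    (F-add-≤-F-product 5 3 (175661 * 1000) 1 (51 * 1156 * 492) a b (1 + b) (F-mono {2} (≤-trans (≤ᵇ⇒≤ 2 4 tt) 4≤a)) (F-suc≤5/3 4≤a)
      (⟦⟧-≤ ((51 * 1156 * 492 * 5 , 2) ∷ [ (51 * 1156 * 492 * 3 , 1) ]) [ (3 * (175661 * 1000) , 0) ] (3 * 1) 9 tt tt 9≤b))
  where
  σY≤XZ : 51 * F b ≤ F a * F (suc (a + (1 + b)))
  σY≤XZ = σ-condition 17 (F b) (F-mono {4} 4≤a) (≤-trans
    (⟦⟧-≤₀ [ (17 , 0) ] ((5 , 2) ∷ [ (3 , 1) ]) 2 tt tt (≤-trans (≤ᵇ⇒≤ 2 9 tt) 9≤b))
    (F-add-mono a (1 + b) (F-mono {5} (s≤s 4≤a)) (F-mono {4} 4≤a)))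
  τX≤YZ : 1156 * F a ≤ F b * F (suc (a + (1 + b)))
  τX≤YZ = τ-condition (F a) (F b) (F b) (*-mono-≤ (F-mono {9} 9≤b) (F-mono {9} 9≤b))
    (≤-trans (*-monoʳ-≤ (F a) (F-suc-mono b)) (F*F≤F-add a (1 + b)))

offset-0-below-370 : ∀ {a b m} → 2 ≤ a → 9 ≤ b →
  MarkoffEquation m (F a) (F b) (F (suc (a + b))) → RatioBelow 370 m (F (suc (a + b)))
offset-0-below-370 {a} {b} 2≤a 9≤b eq =
  ratio-below $ markoff-upper 370 630 4 1156 12712 refl eq (F-suc-pos (a + b)) σY≤XZ τX≤YZ
    (F-add-≤-F-product 2 1 (12712 * 1000) 1 (4 * 1156 * 630) a b b (F-mono {2} 2≤a) (F-suc≤2 (≤-trans (s≤s z≤n) 2≤a))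
      (⟦⟧-≤ ((4 * 1156 * 630 * 2 , 1) ∷ [ (4 * 1156 * 630 * 1 , 0) ]) [ (1 * (12712 * 1000) , 0) ] (1 * 1) 9 tt tt 9≤b))
  where
  σY≤XZ : 4 * F b ≤ F a * F (suc (a + b))
  σY≤XZ = σ-condition 4 (F b) (F-mono {2} 2≤a) (≤-trans
    (⟦⟧-≤₀ [ (4 , 0) ] ((2 , 1) ∷ [ (1 , 0) ]) 2 tt tt (≤-trans (≤ᵇ⇒≤ 2 9 tt) 9≤b))
    (F-add-mono a b (F-mono {3} (s≤s 2≤a)) (F-mono {2} 2≤a)))
  τX≤YZ : 1156 * F a ≤ F b * F (suc (a + b))
  τX≤YZ = τ-condition (F a) (F b) (F b) (*-mono-≤ (F-mono {9} 9≤b) (F-mono {9} 9≤b)) (F*F≤F-add a b)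

offset-0-above-157 : ∀ {a b m} → 7 ≤ a → 7 ≤ b →
  MarkoffEquation m (F a) (F b) (F (suc (a + b))) → RatioAbove 157 m (F (suc (a + b)))
offset-0-above-157 {a} {b} 7≤a 7≤b eq =
  ratio-above $ markoff-lower 157 843 eq (F-suc-pos (a + b))
    (F-product-≤-F-add 21 13 (3 * 1000) 1 843 a b b (F-mono {2} (≤-trans (≤ᵇ⇒≤ 2 7 tt) 7≤a)) (F-suc≥21/13 7≤a)
      (⟦⟧-≤ [ (13 * (3 * 1000) , 0) ] ((843 * 21 , 1) ∷ [ (843 * 13 , 0) ]) (13 * 1) 7 tt tt 7≤b))

offset-0-below-175 : ∀ {a b m} → 7 ≤ a → 7 ≤ b →
  MarkoffEquation m (F a) (F b) (F (suc (a + b))) → RatioBelow 175 m (F (suc (a + b)))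
offset-0-below-175 {a} {b} 7≤a 7≤b eq =
  ratio-below $ markoff-upper 175 825 442 169 223483 refl eq (F-suc-pos (a + b)) σY≤XZ τX≤YZ
    (F-add-≤-F-product 34 21 (223483 * 1000) 1 (442 * 169 * 825) a b b (F-mono {2} (≤-trans (≤ᵇ⇒≤ 2 7 tt) 7≤a)) (F-suc≤34/21 7≤a)
      (⟦⟧-≤ ((442 * 169 * 825 * 34 , 1) ∷ [ (442 * 169 * 825 * 21 , 0) ]) [ (21 * (223483 * 1000) , 0) ] (21 * 1) 7 tt tt 7≤b))
  where
  σY≤XZ : 442 * F b ≤ F a * F (suc (a + b))
  σY≤XZ = σ-condition 34 (F b) (F-mono {7} 7≤a) (≤-trans
    (⟦⟧-≤₀ [ (34 , 0) ] ((21 , 1) ∷ [ (13 , 0) ]) 7 tt tt 7≤b)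
    (F-add-mono a b (F-mono {8} (s≤s 7≤a)) (F-mono {7} 7≤a)))
  τX≤YZ : 169 * F a ≤ F b * F (suc (a + b))
  τX≤YZ = τ-condition (F a) (F b) (F b) (*-mono-≤ (F-mono {7} 7≤b) (F-mono {7} 7≤b)) (F*F≤F-add a b)


-- Tight triples: c = a + b + 1, ratios against F (a + b)

tight-general : ∀ {a b m} → 7 ≤ a → a ≤ b →
  MarkoffEquation m (F a) (F b) (F (suc (a + b))) → RatioBetween 400 460 m (F (a + b))
tight-general {a} {b} 7≤a a≤b eq =
  above-rescale 400 (F (a + b))
    (square-scale 8 5 400 157 (F (a + b)) (F (suc (a + b))) (F-suc≥8/5 (≤-trans (≤ᵇ⇒≤ 4 7 tt) 7≤a+b)) (≤ᵇ⇒≤ _ _ tt))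
    (offset-0-above-157 7≤a 7≤b eq) ,
  below-rescale 460 (F (a + b))
    (square-scale 21 34 175 460 (F (suc (a + b))) (F (a + b)) (F-suc≤34/21 7≤a+b) (≤ᵇ⇒≤ _ _ tt))
    (offset-0-below-175 7≤a 7≤b eq)
  where
  7≤b : 7 ≤ b
  7≤b = ≤-trans 7≤a a≤b
  7≤a+b : 7 ≤ a + b
  7≤a+b = ≤-trans 7≤a (m≤m+n a b)

tight-predecessor : ∀ {p m n} → T (400 ≤ᵇ p) → 4 ≤ n → RatioAbove p m (F (suc n)) → F n * F n ≤ m + 4
tight-predecessor {p} {m} {n} 400≤p 4≤n above =
  ≤-trans (<⇒≤ (*-cancelˡ-< 1000 _ _ (RatioAbove.above (above-rescale 1000 (F n) F-ratio above)))) (m≤m+n m 4)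
  where
  F-ratio : 1000 * (F n * F n) ≤ p * (F (suc n) * F (suc n))
  F-ratio = ≤-trans (square-scale 8 5 1000 400 (F n) (F (suc n)) (F-suc≥8/5 4≤n) (≤ᵇ⇒≤ _ _ tt))
                    (*-monoˡ-≤ (F (suc n) * F (suc n)) (≤ᵇ⇒≤ 400 p 400≤p))

-- Here m / F (2 + b)² → 1, so a ratio bound cannot give the predecessor bound; instead
-- Cassini gives m = F (2 + b)² + 4 ± 8 exactly.
tight-a≡3-predecessor : ∀ {b m} → MarkoffEquation m (F 3) (F b) (F (4 + b)) → F (2 + b) * F (2 + b) ≤ m + 4
tight-a≡3-predecessor {b} {m} (markoff eq) = +-cancelʳ-≤ (3 * 2 * u * Z) _ _ (begin
  (v + u) * (v + u) + 3 * 2 * u * Z                            ≡⟨ e₁ u v ⟩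
  5 * (u * u) + 12 * (u * v) + v * v + 8 * (u * u + u * v)     ≤⟨ +-monoʳ-≤ (5 * (u * u) + 12 * (u * v) + v * v) (*-monoʳ-≤ 8 (cassini-≥ b)) ⟩
  5 * (u * u) + 12 * (u * v) + v * v + 8 * (v * v + 1)         ≡⟨ e₂ u v ⟩
  2 * 2 + u * u + Z * Z + 4                                    ≡⟨ cong (_+ 4) eq ⟩
  3 * 2 * u * Z + m + 4                                        ≡⟨ e₃ (3 * 2 * u * Z) m ⟩
  m + 4 + 3 * 2 * u * Z                                        ∎)
  where
  open ≤-Reasoning
  u = F b
  v = F (suc b)
  Z = ((v + u) + v) + (v + u)
  e₁ : ∀ u v → (v + u) * (v + u) + 3 * 2 * u * (((v + u) + v) + (v + u))
               ≡ 5 * (u * u) + 12 * (u * v) + v * v + 8 * (u * u + u * v)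
  e₁ = solve-∀
  e₂ : ∀ u v → 5 * (u * u) + 12 * (u * v) + v * v + 8 * (v * v + 1)
               ≡ 2 * 2 + u * u + (((v + u) + v) + (v + u)) * (((v + u) + v) + (v + u)) + 4
  e₂ = solve-∀
  e₃ : ∀ k m → k + m + 4 ≡ m + 4 + k
  e₃ = solve-∀

data TightRatio (m w : ℕ) : Set where
  tight-370-460 : RatioBetween 370 460 m w → TightRatio m w
  tight-508-520 : RatioBetween 508 520 m w → TightRatio m w
  tight-906-915 : RatioBetween 906 915 m w → TightRatio m w

≤-cancel-offset : ∀ s k {n b} → T (s + k ≤ᵇ n) → n ≤ s + b → k ≤ b
≤-cancel-offset s k {n} {b} s+k≤n n≤s+b = +-cancelˡ-≤ s k b (≤-trans (≤ᵇ⇒≤ (s + k) n s+k≤n) n≤s+b)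

4≤pred : ∀ {n} → 20 ≤ suc n → 4 ≤ pred n
4≤pred 20≤n+1 = ≤-trans (≤ᵇ⇒≤ 4 18 tt) (<⇒≤pred (≤-pred 20≤n+1))

tight-triple : ∀ {a b m} → 2 ≤ a → a ≤ b → 20 ≤ suc (a + b) →
  MarkoffEquation m (F a) (F b) (F (suc (a + b))) →
  TightRatio m (F (a + b)) × F (pred (a + b)) * F (pred (a + b)) ≤ m + 4
tight-triple {0} () _ _ _
tight-triple {1} (s≤s ()) _ _ _
tight-triple {2} {b} {m} _ _ 20≤c eq = tight-906-915 band , tight-predecessor tt (4≤pred 20≤c) (proj₁ band)
  where
  band : RatioBetween 906 915 m (F (2 + b))
  band = fixed-x-ratio (F 2) 2 1 906 915 26 26 13 (tt , tt , tt) (tt , tt , tt) (≤-cancel-offset 3 13 tt 20≤c) eq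
tight-triple {3} {b} {m} _ _ 20≤c eq = tight-370-460 band , tight-a≡3-predecessor {b} eq
  where
  band : RatioBetween 370 460 m (F (3 + b))
  band = fixed-x-ratio (F 3) 3 2 370 460 63 64 13 (tt , tt , tt) (tt , tt , tt) (≤-cancel-offset 4 13 tt 20≤c) eq
tight-triple {4} {b} {m} _ _ 20≤c eq = tight-508-520 band , tight-predecessor tt (4≤pred 20≤c) (proj₁ band)
  where
  band : RatioBetween 508 520 m (F (4 + b))
  band = fixed-x-ratio (F 4) 4 3 508 520 166 167 13 (tt , tt , tt) (tt , tt , tt) (≤-cancel-offset 5 13 tt 20≤c) eq
tight-triple {5} {b} {m} _ _ 20≤c eq =
  tight-370-460 (above-weaken 370 tt (proj₁ band) , proj₂ band) , tight-predecessor tt (4≤pred 20≤c) (proj₁ band)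
  where
  band : RatioBetween 400 460 m (F (5 + b))
  band = fixed-x-ratio (F 5) 5 4 400 460 425 432 13 (tt , tt , tt) (tt , tt , tt) (≤-cancel-offset 6 13 tt 20≤c) eq
tight-triple {6} {b} {m} _ _ 20≤c eq =
  tight-370-460 (above-weaken 370 tt (proj₁ band) , proj₂ band) , tight-predecessor tt (4≤pred 20≤c) (proj₁ band)
  where
  band : RatioBetween 400 460 m (F (6 + b))
  band = fixed-x-ratio (F 6) 6 5 400 460 1110 1127 13 (tt , tt , tt) (tt , tt , tt) (≤-cancel-offset 7 13 tt 20≤c) eq
tight-triple {a@(suc (suc (suc (suc (suc (suc (suc _)))))))} {b} {m} _ a≤b 20≤c eq =
  tight-370-460 (above-weaken 370 tt (proj₁ band) , proj₂ band) , tight-predecessor tt (4≤pred 20≤c) (proj₁ band)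
  where
  band : RatioBetween 400 460 m (F (a + b))
  band = tight-general (≤ᵇ⇒≤ 7 a tt) a≤b eq


-- Minimal triples: ratios against F c

data MinimalRatio (m z : ℕ) : Set where
  minimal-below-370 : RatioBelow 370 m z → MinimalRatio m z
  minimal-460-508 : RatioBetween 460 508 m z → MinimalRatio m z
  minimal-520-906 : RatioBetween 520 906 m z → MinimalRatio m z
  minimal-above-915 : RatioAbove 915 m z → MinimalRatio m z

tight-minimal-disjoint : ∀ {m w} → TightRatio m w → MinimalRatio m w → ⊥
tight-minimal-disjoint (tight-370-460 (lo , _)) (minimal-below-370 hi) = ratio-separated tt hi lo
tight-minimal-disjoint (tight-370-460 (_ , hi)) (minimal-460-508 (lo , _)) = ratio-separated tt hi lo
tight-minimal-disjoint (tight-370-460 (_ , hi)) (minimal-520-906 (lo , _)) = ratio-separated tt hi lo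
tight-minimal-disjoint (tight-370-460 (_ , hi)) (minimal-above-915 lo) = ratio-separated tt hi lo
tight-minimal-disjoint (tight-508-520 (lo , _)) (minimal-below-370 hi) = ratio-separated tt hi lo
tight-minimal-disjoint (tight-508-520 (lo , _)) (minimal-460-508 (_ , hi)) = ratio-separated tt hi lo
tight-minimal-disjoint (tight-508-520 (_ , hi)) (minimal-520-906 (lo , _)) = ratio-separated tt hi lo
tight-minimal-disjoint (tight-508-520 (_ , hi)) (minimal-above-915 lo) = ratio-separated tt hi lo
tight-minimal-disjoint (tight-906-915 (lo , _)) (minimal-below-370 hi) = ratio-separated tt hi lo
tight-minimal-disjoint (tight-906-915 (lo , _)) (minimal-460-508 (_ , hi)) = ratio-separated tt hi lo
tight-minimal-disjoint (tight-906-915 (lo , _)) (minimal-520-906 (_ , hi)) = ratio-separated tt hi lo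
tight-minimal-disjoint (tight-906-915 (_ , hi)) (minimal-above-915 lo) = ratio-separated tt hi lo

offset-rearrange : ∀ a d b → suc (a + (d + b)) ≡ d + suc (a + b)
offset-rearrange = solve-∀

a+b<c⇒offset : ∀ {a b c} → a + b < c → ∃[ d ] c ≡ suc (a + (d + b))
a+b<c⇒offset {a} {b} {c} a+b<c = c ∸ suc (a + b) , (begin
  c                                ≡⟨ sym (m∸n+n≡m a+b<c) ⟩
  (c ∸ suc (a + b)) + suc (a + b)  ≡⟨ sym (offset-rearrange a (c ∸ suc (a + b)) b) ⟩
  suc (a + ((c ∸ suc (a + b)) + b)) ∎)
  where open ≡-Reasoning

minimal-by-offset : ∀ d {a b m} → 2 ≤ a → a ≤ b → 19 ≤ d + suc (a + b) →
  MarkoffEquation m (F a) (F b) (F (suc (a + (d + b)))) → MinimalRatio m (F (suc (a + (d + b))))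
minimal-by-offset 0 2≤a a≤b 19≤c eq =
  minimal-below-370 (offset-0-below-370 2≤a (≤-larger-summand 9 a≤b (≤-trans (n≤1+n 18) 19≤c)) eq)
minimal-by-offset 1 {0} () _ _ _
minimal-by-offset 1 {1} (s≤s ()) _ _ _
minimal-by-offset 1 {2} {b} {m} _ _ 19≤c eq = minimal-520-906 band
  where
  band : RatioBetween 520 906 m (F (4 + b))
  band = fixed-x-ratio (F 2) 3 3 520 906 64 78 13 (tt , tt , tt) (tt , tt , tt) (≤-cancel-offset 4 13 tt 19≤c) eq
minimal-by-offset 1 {3} {b} {m} _ _ 19≤c eq = minimal-460-508 band
  where
  band : RatioBetween 460 508 m (F (5 + b))
  band = fixed-x-ratio (F 3) 4 4 460 508 174 179 13 (tt , tt , tt) (tt , tt , tt) (≤-cancel-offset 5 13 tt 19≤c) eq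
minimal-by-offset 1 {a@(suc (suc (suc (suc _))))} {b} _ a≤b 19≤c eq =
  minimal-460-508 (offset-1-above-460 4≤a 9≤b eq , offset-1-below-508 4≤a 9≤b eq)
  where
  4≤a : 4 ≤ a
  4≤a = ≤ᵇ⇒≤ 4 a tt
  9≤b : 9 ≤ b
  9≤b = ≤-larger-summand 9 a≤b (≤-pred 19≤c)
minimal-by-offset (suc (suc d)) {a} {b} 2≤a a≤b 19≤c eq with d ≤? 2
... | yes d≤2 = minimal-520-906 (offset-2-4-above-520 2≤a 7≤b Z≥ eq , offset-2-4-below-906 2≤a 7≤b Z≥ Z≤ eq)
  where
  Z≥ : F (suc (a + (2 + b))) ≤ F (suc (a + (suc (suc d) + b)))
  Z≥ = F-mono (s≤s (+-monoʳ-≤ a (+-monoˡ-≤ b (s≤s (s≤s z≤n)))))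
  Z≤ : F (suc (a + (suc (suc d) + b))) ≤ F (suc (a + (4 + b)))
  Z≤ = F-mono (s≤s (+-monoʳ-≤ a (+-monoˡ-≤ b (s≤s (s≤s d≤2)))))
  7≤b : 7 ≤ b
  7≤b = ≤-larger-summand 7 a≤b (≤-trans (n≤1+n 14)
          (+-cancelˡ-≤ 4 15 _ (≤-trans 19≤c (+-monoˡ-≤ (suc (a + b)) (s≤s (s≤s d≤2))))))
... | no d≰2 = minimal-above-915 (offset≥5-above-915 2≤a (≤-trans 2≤a a≤b) Z≥ eq)
  where
  Z≥ : F (suc (a + (5 + b))) ≤ F (suc (a + (suc (suc d) + b)))
  Z≥ = F-mono (s≤s (+-monoʳ-≤ a (+-monoˡ-≤ b (s≤s (s≤s (≰⇒> d≰2))))))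

minimal-triple-ratio : ∀ {a b c m} → 2 ≤ a → a ≤ b → 19 ≤ c → 3 * F a * F b ≤ F c →
  MarkoffEquation m (F a) (F b) (F c) → MinimalRatio m (F c)
minimal-triple-ratio {a} {b} 2≤a a≤b 19≤c minimal eq
  with a+b<c⇒offset {a} {b} (minimal⇒a+b<c 2≤a a≤b (≤-trans (≤ᵇ⇒≤ 5 19 tt) 19≤c) minimal)
... | d , refl = minimal-by-offset d 2≤a a≤b (subst (19 ≤_) (offset-rearrange a d b) 19≤c) eq


squeeze : ∀ {m w} → m + w ≤ w * w → w * w ≤ m + 4 → 5 ≤ w → ⊥
squeeze {m} {w} m+w≤w² w²≤m+4 5≤w = <⇒≱ 5≤w (+-cancelˡ-≤ m w 4 (≤-trans m+w≤w² w²≤m+4))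

loose-triple : ∀ {a b c m} → 2 ≤ a → a ≤ b → suc (a + b) < c →
  MarkoffEquation m (F a) (F b) (F c) → F (pred c) * F (pred c) < m
loose-triple {a} {b} {suc (suc e)} 2≤a a≤b (s≤s (s≤s a+b≤e)) eq =
  markoff-F[c-1]²<m e (F-mono {2} 2≤a) (F-mono {2} 2≤b)
    (≤-trans (3*F*F≤F-add 2≤a 2≤b) (F-mono (s≤s a+b≤e))) eq
  where
  2≤b : 2 ≤ b
  2≤b = ≤-trans 2≤a a≤b

loose-case : ∀ {m a b c a′ b′ c′} → 2 ≤ a → a ≤ b → 20 ≤ c → suc (a + b) < c →
  MarkoffEquation m (F a) (F b) (F c) → MarkoffTriple m (F a′) (F b′) (F c′) → c′ < c → ⊥
loose-case 2≤a a≤b 20≤c a+b+1<c eq triple′ c′<c =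
  squeeze (m+n≤n*n-mono (markoff-m+z≤z*z triple′) (F-mono (<⇒≤pred c′<c)))
          (≤-trans (<⇒≤ (loose-triple 2≤a a≤b a+b+1<c eq)) (m≤m+n _ 4))
          (F-mono {5} (≤-trans (≤ᵇ⇒≤ 5 19 tt) (<⇒≤pred 20≤c)))

tight-case : ∀ {m a b a′ b′ c′} → 2 ≤ a′ → a′ ≤ b′ → 20 ≤ suc (a + b) →
  TightRatio m (F (a + b)) × F (pred (a + b)) * F (pred (a + b)) ≤ m + 4 →
  MinimalMarkoffTriple m (F a′) (F b′) (F c′) → c′ ≤ a + b → ⊥
tight-case 2≤a′ a′≤b′ 20≤c (ratio , predecessor) (triple′@(_ , _ , _ , eq′) , minimal′) c′≤a+b
  with m≤n⇒m<n∨m≡n c′≤a+b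
... | inj₂ refl =
  tight-minimal-disjoint ratio (minimal-triple-ratio 2≤a′ a′≤b′ (≤-pred 20≤c) minimal′ (markoff eq′))
... | inj₁ c′<a+b =
  squeeze (m+n≤n*n-mono (markoff-m+z≤z*z triple′) (F-mono (<⇒≤pred c′<a+b))) predecessor
          (F-mono {5} (≤-trans (≤ᵇ⇒≤ 5 18 tt) (<⇒≤pred (≤-pred 20≤c))))

c′≮c : ∀ {m a b c a′ b′ c′} → 2 ≤ a → a ≤ b → 2 ≤ a′ → a′ ≤ b′ →
  MinimalMarkoffTriple m (F a) (F b) (F c) → MinimalMarkoffTriple m (F a′) (F b′) (F c′) →
  20 ≤ c → ¬ c′ < c
c′≮c {a = a} {b} {a′ = a′} {b′} {c′} 2≤a a≤b 2≤a′ a′≤b′ ((_ , _ , _ , eq) , minimal) minimal-triple′@(triple′ , _) 20≤c c′<c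
  with m≤n⇒m<n∨m≡n (minimal⇒a+b<c 2≤a a≤b (≤-trans (≤ᵇ⇒≤ 5 20 tt) 20≤c) minimal)
... | inj₁ a+b+1<c = loose-case {a′ = a′} {b′} {c′} 2≤a a≤b 20≤c a+b+1<c (markoff eq) triple′ c′<c
... | inj₂ refl = tight-case {a = a} {b} 2≤a′ a′≤b′ 20≤c (tight-triple 2≤a a≤b 20≤c (markoff eq)) minimal-triple′ (≤-pred c′<c)

-- The hypothesis 0 < m is unused (for m = 0 there are no minimal triples).
lemma4p15 : (m a b c a′ b′ c′ : ℕ) → 0 < m →
    2 ≤ a → a ≤ b → b ≤ c → 2 ≤ a′ → a′ ≤ b′ → b′ ≤ c′ →
    MinimalMarkoffTriple m (F a) (F b) (F c) →
    MinimalMarkoffTriple m (F a′) (F b′) (F c′) →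
    20 ≤ c → c ≡ c′
lemma4p15 m a b c a′ b′ c′ _ 2≤a a≤b _ 2≤a′ a′≤b′ _ T T′ 20≤c with <-cmp c c′
... | tri< c<c′ _ _ = ⊥-elim (c′≮c 2≤a′ a′≤b′ 2≤a a≤b T′ T (≤-trans 20≤c (<⇒≤ c<c′)) c<c′)
... | tri≈ _ c≡c′ _ = c≡c′
... | tri> _ _ c′<c = ⊥-elim (c′≮c 2≤a a≤b 2≤a′ a′≤b′ T T′ 20≤c c′<c)
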